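{- Let $P$ be a program and $\sigma$ a sequence of labels such that the Power automaton of $P$ moves from its initial state via $\sigma$ to some final state $s$. Then $s$ is uniquely determined by $\sigma$.
   Context: Programs. Fix a finite set $D$ of values, which also serves as the set of addresses, with $0\in D$; a finite set $\mathit{Reg}$ of registers taking values in $D$; and a set of functions over $D\cup\{\bot\}$, each returning $\bot$ iff some argument is $\bot$. Expressions are built from constants in $D$, registers, and these functions. Commands are: loads $r\leftarrow \mathrm{mem}[e]$, stores $\mathrm{mem}[e]\leftarrow e'$, local assignments $r\leftarrow e$, and $\mathrm{assume}(e)$. A program $P=T_1\cdots T_n$ is a finite sequence of threads with ids $\mathit{Tid}=\{1,\dots,n\}$; thread $T_t$ is a finite automaton with control states $Q_t$ (all final), initial state $q^0_t$, and a finite set $I_t$ of transitions (called instructions) labeled by commands. Power semantics (Power automaton). A state is $(R,(co,prop))$. For each thread $t$, $R(t)=(F,C,L)$ where $F\in I_t^*$ is the sequence of fetched instructions, $C\subseteq[1..|F|]$ the committed indices, and $L:[1..|F|]\to\{\bot\}\cup\{\mathit{init}_a: a\in D\}\cup \mathit{Tid}\times\mathbb N$ records the store read by each load ($\mathit{init}_a$ is an initial store of value $0$ to address $a$; $(t',i')$ denotes the $i'$-th fetched instruction of thread $t'$). $co$ assigns rational coherence keys to committed stores (and key $0$ to initial stores); $prop(t,a)$ is the last store to address $a$ propagated to thread $t$. Initially all $F$ are empty, $C=\emptyset$, $L\equiv\bot$, no program store has a key, and $prop(t,a)=\mathit{init}_a$. For the $i$-th fetched instruction of thread $t$, $\mathit{eval}(t,i,e)$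 is: $e$ if $e\in D$; $f(\mathit{eval}(t,i,e_1),\dots)$ for $e=f(e_1,\dots)$; for a register $r$, let $i'<i$ be the greatest index such that $F[i']$ is an assignment or a load to $r$: if none, $0$; if $F[i']$ is $r\leftarrow e_v$, then $\mathit{eval}(t,i',e_v)$; if $F[i']$ is a load, then $\bot$ if $L[i']=\bot$, $0$ if $L[i']$ is an initial store, and otherwise the value argument of store $L[i']$. $\mathit{getaddr}(t,i)$ is the evaluated address expression of a load/store and $\top$ for other instructions; $\mathit{getvalue}(t,i)$ is the evaluated value expression of a store, assignment or assume, and $\top$ for loads. Address and data dependencies of instruction $i$ are the earlier instructions defining (recursively) the registers in its address, resp.\ value expression; control dependencies are all earlier assume instructions. Transitions (labels in parentheses): (FETCH) $(\mathrm{fetch},t,\iota)$: append instruction $\iota\in I_t$ to $F$ if its source state is the target of the last fetched instruction (or $q^0_t$ if $F$ is empty). (LOAD) $(\mathrm{ld},t,i,a)$: if $F[i]$ is a load, $L[i]=\bot$, $a=\mathit{getaddr}(t,i)\ne\bot$, set $L[i]:=prop(t,a)$. (EARLY) $(\mathrm{ld},t,i,a)$: if $F[i]$ is a load, $L[i]=\bot$, $a=\mathit{getaddr}(t,i)\neq\bot$, and the greatest $i'<i$ such that $F[i']$ is a store with $\mathit{getaddr}(t,i')\in\{a,\bot\}$ satisfies $\mathit{getaddr}(t,i')=a$, $\mathit{getvalue}(t,i')\ne\bot$, $i'\notin C$, set $L[i]:=(t,i')$. (COMMIT) $(\mathrm{commit},t,i)$ for a non-store $i\notin C$: requires all address, data,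 control dependencies committed, $\mathit{getaddr},\mathit{getvalue}\ne\bot$, if the address $a\ne\top$ then all $i'<i$ with $\mathit{getaddr}(t,i')\in\{a,\bot\}$ committed, $L[i]\ne\bot$ for loads, value $\neq0$ for assumes; adds $i$ to $C$. (STORE) $(\mathrm{commit},t,i,k,a)$: same preconditions for a store $i$ with address $a$, choosing a coherence key $k\in\mathbb Q$ not used by any other store; sets $co(t,i):=k$, adds $i$ to $C$, and is immediately followed by propagation of this store to thread $t$. (PROP) $(\mathrm{prop},t,t',i',a)$: if store $(t',i')$ is committed, has address $a$, and $co(prop(t,a))<co(t',i')$, set $prop(t,a):=(t',i')$. Final states: every fetched instruction is committed; for loads $i'<i$ of the same thread and address, $co(L[i'])\le co(L[i])$; for a store $i'$ and a load $i$ of the same thread and address with $i'<i$, $co(t,i')\le co(L[i])$. -}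

module Defs where

open import Data.Nat using (ℕ; zero; suc; _<_; _≤_; _≡ᵇ_)
open import Data.Fin using (Fin; zero; suc; _≟_)
open import Data.Bool using (Bool; true; false; if_then_else_; _∧_)
open import Data.Maybe using (Maybe; just; nothing; _>>=_)
import Data.Maybe as Maybe
open import Data.List using (List; []; _∷_; _++_; [_]; length)
open import Data.List.Membership.Propositional using (_∈_)
open import Data.Vec using (Vec)
import Data.Vec as Vec
open import Data.Vec.Relation.Unary.Any using (Any)
open import Data.Rational using (ℚ; 0ℚ)
import Data.Rational as ℚ
open import Data.Product using (Σ; _×_; _,_; ∃)
open import Data.Sum using (_⊎_)
open import Data.Empty using (⊥)
open import Relation.Nullary using (¬_; does)
open import Relation.Binary.PropositionalEquality using (_≡_; _≢_; refl)

module Power (dm nr : ℕ) where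

  D : Set
  D = Fin (suc dm)

  𝟘 : D
  𝟘 = zero

  Reg : Set
  Reg = Fin nr

  -- A k-ary function over D ∪ {⊥} (⊥ = nothing) returning ⊥ iff some argument is ⊥.
  record SFun (k : ℕ) : Set where
    field
      fn     : Vec (Maybe D) k → Maybe D
      strict : ∀ v → (fn v ≡ nothing → Any (_≡ nothing) v)
                   × (Any (_≡ nothing) v → fn v ≡ nothing)

  data Expr : Set where
    const : D → Expr
    reg   : Reg → Expr
    app   : ∀ {k} → SFun k → Vec Expr k → Expr

  data RegIn (r : Reg) : Expr → Set where
    here  : RegIn r (reg r)
    inArg : ∀ {k} {f : SFun k} {es : Vec Expr k} → Any (RegIn r) es → RegIn r (app f es)

  data Cmd : Set where
    load   : Reg → Expr → Cmd
    store  : Expr → Expr → Cmd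
    assign : Reg → Expr → Cmd
    assume : Expr → Cmd

  record Instr (q : ℕ) : Set where
    constructor ⟨_,_,_⟩
    field
      src : Fin q
      cmd : Cmd
      tgt : Fin q

  record Thread : Set where
    field
      Q  : ℕ                 -- control states are Fin Q (all final)
      q0 : Fin Q
      I  : List (Instr Q)

  record Program : Set where
    field
      n   : ℕ
      thr : Fin n → Thread

  addrExpr : Cmd → Maybe Expr
  addrExpr (load _ e)    = just e
  addrExpr (store e _)   = just e
  addrExpr (assign _ _)  = nothing
  addrExpr (assume _)    = nothing

  valExpr : Cmd → Maybe Expr
  valExpr (load _ _)    = nothing
  valExpr (store _ e)   = just e
  valExpr (assign _ e)  = just e
  valExpr (assume e)    = just e

  Defines : Cmd → Reg → Set
  Defines (load r _)   r' = r ≡ r'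
  Defines (assign r _) r' = r ≡ r'
  Defines (store _ _)  r' = ⊥
  Defines (assume _)   r' = ⊥

  IsAssume : Cmd → Set
  IsAssume c = Σ Expr λ e → c ≡ assume e

  -- 1-based list indexing: at xs i = xs[i] for i ∈ [1..|xs|]
  at : ∀ {A : Set} → List A → ℕ → Maybe A
  at []       _             = nothing
  at (x ∷ xs) zero          = nothing
  at (x ∷ xs) (suc zero)    = just x
  at (x ∷ xs) (suc (suc i)) = at xs (suc i)

  _<m_ : Maybe ℚ → Maybe ℚ → Set
  just x <m just y = x ℚ.< y
  _      <m _      = ⊥

  _≤m_ : Maybe ℚ → Maybe ℚ → Set
  just x ≤m just y = x ℚ.≤ y
  _      ≤m _      = ⊥

  module Sem (P : Program) where
    open Program P

    Tid : Set
    Tid = Fin n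

    InstrOf : Tid → Set
    InstrOf t = Instr (Thread.Q (thr t))

    -- stores: initial stores init_a, and program stores (t , i)
    data Ref : Set where
      init : D → Ref
      st   : Tid → ℕ → Ref

    record TState (t : Tid) : Set where
      field
        F : List (InstrOf t)
        C : ℕ → Bool             -- committed indices (meaningful on [1..|F|])
        L : ℕ → Maybe Ref        -- store read by each load (nothing = ⊥)

    record State : Set where
      field
        R    : (t : Tid) → TState t
        co   : Ref → Maybe ℚ     -- coherence keys (nothing = no key)
        prop : Tid → D → Ref

    open TState public
    open State public

    initState : State
    initState = record
      { R    = λ t → record { F = [] ; C = λ _ → false ; L = λ _ → nothing }
      ; co   = λ { (init _) → just 0ℚ ; (st _ _) → nothing }
      ; prop = λ _ a → init a }

    cmdAt : State → Tid → ℕ → Maybe Cmd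
    cmdAt s t i = Maybe.map Instr.cmd (at (F (R s t)) i)

    Cm : State → Tid → ℕ → Bool
    Cm s t i = C (R s t) i

    Lm : State → Tid → ℕ → Maybe Ref
    Lm s t i = L (R s t) i

    coL : State → Tid → ℕ → Maybe ℚ
    coL s t i = Lm s t i >>= co s

    DefAt : State → Tid → ℕ → Reg → Set
    DefAt s t j r = Σ Cmd λ c → cmdAt s t j ≡ just c × Defines c r

    LastDef : State → Tid → ℕ → Reg → ℕ → Set
    LastDef s t i r j = j < i × DefAt s t j r × (∀ k → j < k → k < i → ¬ DefAt s t k r)

    NoDef : State → Tid → ℕ → Reg → Set
    NoDef s t i r = ∀ j → j < i → ¬ DefAt s t j r

    -- eval(t,i,e) = v, as the inductive relation generated by the defining equations
    mutual
      data Eval (s : State) : Tid → ℕ → Expr → Maybe D → Set where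
        ev-const : ∀ {t i d} → Eval s t i (const d) (just d)
        ev-app   : ∀ {t i k} {f : SFun k} {es : Vec Expr k} {vs : Vec (Maybe D) k} →
                   EvalV s t i es vs → Eval s t i (app f es) (SFun.fn f vs)
        ev-none  : ∀ {t i r} → NoDef s t i r → Eval s t i (reg r) (just 𝟘)
        ev-assign : ∀ {t i r j e v} → LastDef s t i r j → cmdAt s t j ≡ just (assign r e) →
                   Eval s t j e v → Eval s t i (reg r) v
        ev-load⊥ : ∀ {t i r j e} → LastDef s t i r j → cmdAt s t j ≡ just (load r e) →
                   Lm s t j ≡ nothing → Eval s t i (reg r) nothing
        ev-loadInit : ∀ {t i r j e a} → LastDef s t i r j → cmdAt s t j ≡ just (load r e) →
                   Lm s t j ≡ just (init a) → Eval s t i (reg r) (just 𝟘)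
        ev-loadSt : ∀ {t i r j e t' i' ea ev v} → LastDef s t i r j → cmdAt s t j ≡ just (load r e) →
                   Lm s t j ≡ just (st t' i') → cmdAt s t' i' ≡ just (store ea ev) →
                   Eval s t' i' ev v → Eval s t i (reg r) v

      data EvalV (s : State) (t : Tid) (i : ℕ) : ∀ {k} → Vec Expr k → Vec (Maybe D) k → Set where
        []  : EvalV s t i Vec.[] Vec.[]
        _∷_ : ∀ {k e v} {es : Vec Expr k} {vs : Vec (Maybe D) k} →
              Eval s t i e v → EvalV s t i es vs → EvalV s t i (e Vec.∷ es) (v Vec.∷ vs)

    data DepE (s : State) (t : Tid) : ℕ → Expr → ℕ → Set where
      dep-direct : ∀ {i e r j} → RegIn r e → LastDef s t i r j → DepE s t i e j
      dep-trans  : ∀ {i e r j' e' j} → RegIn r e → LastDef s t i r j' →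
                   cmdAt s t j' ≡ just (assign r e') → DepE s t j' e' j → DepE s t i e j

    AddrDep : State → Tid → ℕ → ℕ → Set
    AddrDep s t i j = Σ Cmd λ c → Σ Expr λ e →
      cmdAt s t i ≡ just c × addrExpr c ≡ just e × DepE s t i e j

    DataDep : State → Tid → ℕ → ℕ → Set
    DataDep s t i j = Σ Cmd λ c → Σ Expr λ e →
      cmdAt s t i ≡ just c × valExpr c ≡ just e × DepE s t i e j

    DepsCommitted : State → Tid → ℕ → Set
    DepsCommitted s t i =
        (∀ j → AddrDep s t i j → Cm s t j ≡ true)
      × (∀ j → DataDep s t i j → Cm s t j ≡ true)
      × (∀ j → j < i → (Σ Cmd λ c → cmdAt s t j ≡ just c × IsAssume c) → Cm s t j ≡ true)

    AddrIn : State → Tid → ℕ → D → Set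
    AddrIn s t j a = Σ Cmd λ c → Σ Expr λ e →
      cmdAt s t j ≡ just c × addrExpr c ≡ just e × (Eval s t j e (just a) ⊎ Eval s t j e nothing)

    SameAddrCommitted : State → Tid → ℕ → D → Set
    SameAddrCommitted s t i a = ∀ j → j < i → AddrIn s t j a → Cm s t j ≡ true

    CmdReady : State → Tid → ℕ → Cmd → Set
    CmdReady s t i (load r e)   = Σ D λ a → Eval s t i e (just a) × SameAddrCommitted s t i a
                                          × Lm s t i ≢ nothing
    CmdReady s t i (store _ _)  = ⊥
    CmdReady s t i (assign r e) = Σ D λ v → Eval s t i e (just v)
    CmdReady s t i (assume e)   = Σ D λ v → Eval s t i e (just v) × v ≢ 𝟘

    updR : State → Tid → (∀ {t'} → TState t' → TState t') → State
    updR s t f = record s { R = λ t' → if does (t' ≟ t) then f (R s t') else R s t' }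

    appendF : State → (t : Tid) → InstrOf t → State
    appendF s t ι = record s { R = newR }
      where
        newR : (t' : Tid) → TState t'
        newR t' with t' ≟ t
        ... | Relation.Nullary.yes refl = record (R s t) { F = F (R s t) ++ [ ι ] }
        ... | Relation.Nullary.no _     = R s t'

    setL : State → Tid → ℕ → Maybe Ref → State
    setL s t i v = updR s t (λ ts → record ts { L = λ j → if j ≡ᵇ i then v else L ts j })

    setC : State → Tid → ℕ → State
    setC s t i = updR s t (λ ts → record ts { C = λ j → if j ≡ᵇ i then true else C ts j })

    setCo : State → Tid → ℕ → ℚ → State
    setCo s t i k = record s { co = newco }
      where
        newco : Ref → Maybe ℚ
        newco (init a)  = co s (init a)
        newco (st t' i') = if does (t' ≟ t) ∧ (i' ≡ᵇ i) then just k else co s (st t' i')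

    setProp : State → Tid → D → Ref → State
    setProp s t a ρ = record s
      { prop = λ t' a' → if does (t' ≟ t) ∧ does (a' ≟ a) then ρ else prop s t' a' }

    lastTgt : ∀ {q} → Fin q → List (Instr q) → Fin q
    lastTgt q []       = q
    lastTgt q (x ∷ xs) = lastTgt (Instr.tgt x) xs

    data Label : Set where
      fetch    : (t : Tid) → InstrOf t → Label
      ld       : Tid → ℕ → D → Label
      commit   : Tid → ℕ → Label
      commitSt : Tid → ℕ → ℚ → D → Label
      propL    : Tid → Tid → ℕ → D → Label

    data Step (s : State) : Label → State → Set where
      FETCH : ∀ {t} {ι : InstrOf t} → ι ∈ Thread.I (thr t) →
              Instr.src ι ≡ lastTgt (Thread.q0 (thr t)) (F (R s t)) →
              Step s (fetch t ι) (appendF s t ι)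
      LOAD  : ∀ {t i a r e} → cmdAt s t i ≡ just (load r e) → Lm s t i ≡ nothing →
              Eval s t i e (just a) →
              Step s (ld t i a) (setL s t i (just (prop s t a)))
      EARLY : ∀ {t i a r e i' ea ev} → cmdAt s t i ≡ just (load r e) → Lm s t i ≡ nothing →
              Eval s t i e (just a) →
              -- i' is the greatest index < i that is a store with getaddr ∈ {a, ⊥}
              i' < i → cmdAt s t i' ≡ just (store ea ev) →
              (∀ j → i' < j → j < i → ∀ ea' ev' → cmdAt s t j ≡ just (store ea' ev') →
                 ¬ Eval s t j ea' (just a) × ¬ Eval s t j ea' nothing) →
              Eval s t i' ea (just a) → (Σ D λ v → Eval s t i' ev (just v)) →
              Cm s t i' ≡ false →
              Step s (ld t i a) (setL s t i (just (st t i')))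
      COMMIT : ∀ {t i c} → cmdAt s t i ≡ just c → Cm s t i ≡ false →
              DepsCommitted s t i → CmdReady s t i c →
              Step s (commit t i) (setC s t i)
      STORE : ∀ {t i k a ea ev} → cmdAt s t i ≡ just (store ea ev) → Cm s t i ≡ false →
              DepsCommitted s t i → Eval s t i ea (just a) → (Σ D λ v → Eval s t i ev (just v)) →
              SameAddrCommitted s t i a →
              (∀ ρ → ρ ≢ st t i → co s ρ ≢ just k) →
              -- the immediately following propagation to t must be enabled
              co s (prop s t a) <m just k →
              Step s (commitSt t i k a) (setProp (setCo (setC s t i) t i k) t a (st t i))
      PROP  : ∀ {t t' i' a ea ev} → Cm s t' i' ≡ true → cmdAt s t' i' ≡ just (store ea ev) →
              Eval s t' i' ea (just a) → co s (prop s t a) <m co s (st t' i') →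
              Step s (propL t t' i' a) (setProp s t a (st t' i'))

    data Run : State → List Label → State → Set where
      done : ∀ {s} → Run s [] s
      step : ∀ {s l s' σ s''} → Step s l s' → Run s' σ s'' → Run s (l ∷ σ) s''

    Final : State → Set
    Final s =
        (∀ t i → 1 ≤ i → i ≤ length (F (R s t)) → Cm s t i ≡ true)
      × (∀ t i' i a r' e' r e → i' < i →
           cmdAt s t i' ≡ just (load r' e') → cmdAt s t i ≡ just (load r e) →
           Eval s t i' e' (just a) → Eval s t i e (just a) → coL s t i' ≤m coL s t i)
      × (∀ t i' i a ea ev r e → i' < i →
           cmdAt s t i' ≡ just (store ea ev) → cmdAt s t i ≡ just (load r e) →
           Eval s t i' ea (just a) → Eval s t i e (just a) → co s (st t i') ≤m coL s t i)

    -- equality of states (as mathematical objects; functions compared on their domains)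
    _≈S_ : State → State → Set
    s ≈S s' =
        (∀ t → F (R s t) ≡ F (R s' t)
             × (∀ i → 1 ≤ i → i ≤ length (F (R s t)) → Cm s t i ≡ Cm s' t i × Lm s t i ≡ Lm s' t i))
      × (∀ ρ → co s ρ ≡ co s' ρ)
      × (∀ t a → prop s t a ≡ prop s' t a)

-- Every label except (ld t i a) determines its successor state.  That label may be a LOAD
-- reading the store propagated to t for a, say with key q, or an EARLY read of an earlier
-- uncommitted store i' of t to a.  If the LOAD is taken while EARLY is enabled, the key of
-- the store propagated to t for a never drops below q afterwards, and since committing i'
-- propagates it to t at once, i' receives a key above q.  The final state condition demands
-- co(i') ≤ co(L[i]) = q, so no final state is reachable and the choice in a run ending in a
-- final state is forced.  Induction on the run then identifies the two final states.  This
-- needs that keys, once assigned, never change (uncommitted stores have none) and that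
-- evaluation is deterministic and survives the growth of the thread states.
module Submission where

open import Defs
open import Data.Nat using (ℕ; zero; suc; _<_; _≤_; _≡ᵇ_; z≤n; s≤s)
import Data.Nat.Properties as ℕ
open import Data.Fin using (_≟_)
open import Data.Bool using (true; false; T)
open import Data.Maybe using (just; nothing)
import Data.Maybe as Maybe
open import Data.Maybe.Properties using (just-injective)
open import Data.List using (List; []; _∷_; _++_; [_]; length)
open import Data.List.Properties using (++-identityʳ; ++-assoc)
open import Data.Vec using (Vec)
import Data.Vec as Vec
open import Data.Vec.Relation.Unary.Any using (Any; here; there)
open import Data.Rational using (ℚ)
import Data.Rational as ℚ
import Data.Rational.Properties as ℚₚ
open import Data.Product using (∃; ∃₂; _×_; _,_; proj₁; proj₂)
open import Data.Sum using (_⊎_; inj₁; inj₂)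
open import Data.Empty using (⊥-elim)
open import Data.Unit using (tt)
open import Function using (_∘_; case_of_)
open import Relation.Binary using (tri<; tri≈; tri>)
open import Relation.Nullary using (¬_; yes; no; does)
open import Relation.Nullary.Decidable using (dec-true)
open import Relation.Binary.PropositionalEquality hiding ([_])

module Determinism (dm nr : ℕ) (P : Power.Program dm nr) where
  open Power dm nr
  open Sem P

  len : State → Tid → ℕ
  len s t = length (F (R s t))

  at-++ˡ : ∀ {A : Set} (xs ys : List A) {i} → i ≤ length xs → at (xs ++ ys) i ≡ at xs i
  at-++ˡ []       []      z≤n = refl
  at-++ˡ []       (_ ∷ _) z≤n = refl
  at-++ˡ (_ ∷ _)  _       {zero}        _         = refl
  at-++ˡ (_ ∷ _)  _       {suc zero}    _         = refl
  at-++ˡ (_ ∷ xs) ys      {suc (suc i)} (s≤s i≤) = at-++ˡ xs ys i≤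

  at-just⇒≤length : ∀ {A : Set} (xs : List A) i {x} → at xs i ≡ just x → i ≤ length xs
  at-just⇒≤length (_ ∷ _)  (suc zero)    _  = s≤s z≤n
  at-just⇒≤length (_ ∷ xs) (suc (suc i)) eq = s≤s (at-just⇒≤length xs (suc i) eq)

  cmdAt-just⇒≤len : ∀ s t i {c} → cmdAt s t i ≡ just c → i ≤ len s t
  cmdAt-just⇒≤len s t i eq with at (F (R s t)) i in e
  ... | just _ = at-just⇒≤length (F (R s t)) i e

  ≡ᵇ-refl : ∀ i → (i ≡ᵇ i) ≡ true
  ≡ᵇ-refl zero    = refl
  ≡ᵇ-refl (suc i) = ≡ᵇ-refl i

  ≡ᵇ-true⇒≡ : ∀ {j i} → (j ≡ᵇ i) ≡ true → j ≡ i
  ≡ᵇ-true⇒≡ {j} {i} eq = ℕ.≡ᵇ⇒≡ j i (subst T (sym eq) tt)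

  setL-frame : ∀ s t i v t' → F (R (setL s t i v) t') ≡ F (R s t') × C (R (setL s t i v) t') ≡ C (R s t')
  setL-frame s t i v t' with does (t' ≟ t)
  ... | true  = refl , refl
  ... | false = refl , refl

  setC-frame : ∀ s t i t' → F (R (setC s t i) t') ≡ F (R s t') × L (R (setC s t i) t') ≡ L (R s t')
  setC-frame s t i t' with does (t' ≟ t)
  ... | true  = refl , refl
  ... | false = refl , refl

  Lm-setL : ∀ s t i v t' j → Lm (setL s t i v) t' j ≡ Lm s t' j ⊎ (t' ≡ t × j ≡ i)
  Lm-setL s t i v t' j with t' ≟ t
  ... | no _ = inj₁ refl
  ... | yes t'≡t with j ≡ᵇ i in eq
  ...   | true  = inj₂ (t'≡t , ≡ᵇ-true⇒≡ eq)
  ...   | false = inj₁ refl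

  Lm-setL-self : ∀ s t i v → Lm (setL s t i v) t i ≡ v
  Lm-setL-self s t i v rewrite dec-true (t ≟ t) refl | ≡ᵇ-refl i = refl

  Cm-setC-mono : ∀ s t i t' j → Cm s t' j ≡ true → Cm (setC s t i) t' j ≡ true
  Cm-setC-mono s t i t' j h with does (t' ≟ t)
  ... | false = h
  ... | true with j ≡ᵇ i
  ...   | true  = refl
  ...   | false = h

  Cm-setC-self : ∀ s t i → Cm (setC s t i) t i ≡ true
  Cm-setC-self s t i rewrite dec-true (t ≟ t) refl | ≡ᵇ-refl i = refl

  co-setCo : ∀ s t i k t' j → co (setCo s t i k) (st t' j) ≡ co s (st t' j) ⊎ (t' ≡ t × j ≡ i)
  co-setCo s t i k t' j with t' ≟ t
  ... | no _ = inj₁ refl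
  ... | yes t'≡t with j ≡ᵇ i in eq
  ...   | true  = inj₂ (t'≡t , ≡ᵇ-true⇒≡ eq)
  ...   | false = inj₁ refl

  co-setCo-self : ∀ s t i k → co (setCo s t i k) (st t i) ≡ just k
  co-setCo-self s t i k rewrite dec-true (t ≟ t) refl | ≡ᵇ-refl i = refl

  prop-setProp : ∀ s t a ρ t' a' → prop (setProp s t a ρ) t' a' ≡ prop s t' a' ⊎ (t' ≡ t × a' ≡ a)
  prop-setProp s t a ρ t' a' with t' ≟ t | a' ≟ a
  ... | yes t'≡t | yes a'≡a = inj₂ (t'≡t , a'≡a)
  ... | yes _    | no _     = inj₁ refl
  ... | no _     | _        = inj₁ refl

  prop-setProp-self : ∀ s t a ρ → prop (setProp s t a ρ) t a ≡ ρ
  prop-setProp-self s t a ρ rewrite dec-true (t ≟ t) refl | dec-true (a ≟ a) refl = refl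

  record _⊑_ (s s' : State) : Set where
    field
      fetched-grows  : ∀ t → ∃ λ ys → F (R s' t) ≡ F (R s t) ++ ys
      loads-stable   : ∀ t j {ρ} → Lm s t j ≡ just ρ → Lm s' t j ≡ just ρ
      commits-stable : ∀ t j → Cm s t j ≡ true → Cm s' t j ≡ true
  open _⊑_

  ⊑-refl : ∀ {s} → s ⊑ s
  ⊑-refl = record
    { fetched-grows  = λ t → [] , sym (++-identityʳ _)
    ; loads-stable   = λ _ _ h → h
    ; commits-stable = λ _ _ h → h }

  ⊑-trans : ∀ {s₁ s₂ s₃} → s₁ ⊑ s₂ → s₂ ⊑ s₃ → s₁ ⊑ s₃
  ⊑-trans {s₁} {s₃ = s₃} ex₁ ex₂ = record
    { fetched-grows  = grows
    ; loads-stable   = λ t j h → loads-stable ex₂ t j (loads-stable ex₁ t j h)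
    ; commits-stable = λ t j h → commits-stable ex₂ t j (commits-stable ex₁ t j h) }
    where
      grows : ∀ t → ∃ λ ys → F (R s₃ t) ≡ F (R s₁ t) ++ ys
      grows t with ys , eq₁ ← fetched-grows ex₁ t | zs , eq₂ ← fetched-grows ex₂ t =
        ys ++ zs , trans eq₂ (trans (cong (_++ zs) eq₁) (++-assoc (F (R s₁ t)) ys zs))

  -- setCo and setProp leave the thread states alone, which unification does not see.
  ⊑-sameThreads : ∀ {s s₁ s₂} → s ⊑ s₁ → (∀ t → R s₂ t ≡ R s₁ t) → s ⊑ s₂
  ⊑-sameThreads {s} {s₁} {s₂} ex eq = record
    { fetched-grows  = λ t → subst (λ ts → ∃ λ ys → F ts ≡ F (R s t) ++ ys) (sym (eq t)) (fetched-grows ex t)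
    ; loads-stable   = λ t j h → subst (λ ts → L ts j ≡ _) (sym (eq t)) (loads-stable ex t j h)
    ; commits-stable = λ t j h → subst (λ ts → C ts j ≡ true) (sym (eq t)) (commits-stable ex t j h) }

  setL-⊑ : ∀ s t i v → Lm s t i ≡ nothing → s ⊑ setL s t i v
  setL-⊑ s t i v unread = record
    { fetched-grows  = λ t' → [] , trans (proj₁ (setL-frame s t i v t')) (sym (++-identityʳ _))
    ; loads-stable   = stable
    ; commits-stable = λ t' j h → trans (cong (λ c → c j) (proj₂ (setL-frame s t i v t'))) h }
    where
      stable : ∀ t' j {ρ} → Lm s t' j ≡ just ρ → Lm (setL s t i v) t' j ≡ just ρ
      stable t' j h with Lm-setL s t i v t' j
      ... | inj₁ eq = trans eq h
      ... | inj₂ (refl , refl) with () ← trans (sym unread) h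

  setC-⊑ : ∀ s t i → s ⊑ setC s t i
  setC-⊑ s t i = record
    { fetched-grows  = λ t' → [] , trans (proj₁ (setC-frame s t i t')) (sym (++-identityʳ _))
    ; loads-stable   = λ t' j h → trans (cong (λ l → l j) (proj₂ (setC-frame s t i t'))) h
    ; commits-stable = Cm-setC-mono s t i }

  appendF-⊑ : ∀ s t ι → s ⊑ appendF s t ι
  appendF-⊑ s t ι = record
    { fetched-grows  = grows
    ; loads-stable   = loads
    ; commits-stable = commits }
    where
      grows : ∀ t' → ∃ λ ys → F (R (appendF s t ι) t') ≡ F (R s t') ++ ys
      grows t' with t' ≟ t
      ... | yes refl = [ ι ] , refl
      ... | no _     = [] , sym (++-identityʳ _)
      loads : ∀ t' j {ρ} → Lm s t' j ≡ just ρ → Lm (appendF s t ι) t' j ≡ just ρ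
      loads t' j h with t' ≟ t
      ... | yes refl = h
      ... | no _     = h
      commits : ∀ t' j → Cm s t' j ≡ true → Cm (appendF s t ι) t' j ≡ true
      commits t' j h with t' ≟ t
      ... | yes refl = h
      ... | no _     = h

  step-⊑ : ∀ {s l s'} → Step s l s' → s ⊑ s'
  step-⊑ {s} (FETCH {t} {ι} _ _)                     = appendF-⊑ s t ι
  step-⊑ {s} (LOAD {t} {i} _ unread _)               = setL-⊑ s t i _ unread
  step-⊑ {s} (EARLY {t} {i} _ unread _ _ _ _ _ _ _)  = setL-⊑ s t i _ unread
  step-⊑ {s} (COMMIT {t} {i} _ _ _ _)                = setC-⊑ s t i
  step-⊑ {s} (STORE {t} {i} _ _ _ _ _ _ _ _)         = ⊑-sameThreads (setC-⊑ s t i) (λ _ → refl)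
  step-⊑     (PROP _ _ _ _)                          = ⊑-sameThreads ⊑-refl (λ _ → refl)

  run-preserves : (I : State → Set) → (∀ {s l s'} → I s → Step s l s' → I s') →
                  ∀ {s σ s'} → I s → Run s σ s' → I s'
  run-preserves I step-I i done         = i
  run-preserves I step-I i (step stp r) = run-preserves I step-I (step-I i stp) r

  run-⊑ : ∀ {s σ s'} → Run s σ s' → s ⊑ s'
  run-⊑ {s} = run-preserves (s ⊑_) (λ ex stp → ⊑-trans ex (step-⊑ stp)) ⊑-refl

  uncommitted-⊒ : ∀ {s s'} → s ⊑ s' → ∀ t j → Cm s' t j ≡ false → Cm s t j ≡ false
  uncommitted-⊒ {s} ex t j h with Cm s t j in eq
  ... | false = refl
  ... | true with () ← trans (sym (commits-stable ex t j eq)) h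

  cmdAt-⊑ : ∀ {s s'} → s ⊑ s' → ∀ t j → j ≤ len s t → cmdAt s' t j ≡ cmdAt s t j
  cmdAt-⊑ {s} ex t j j≤ with ys , eq ← fetched-grows ex t rewrite eq =
    cong (Maybe.map Instr.cmd) (at-++ˡ (F (R s t)) ys j≤)

  cmdAt-⊑-just : ∀ {s s'} → s ⊑ s' → ∀ t j {c} → cmdAt s t j ≡ just c → cmdAt s' t j ≡ just c
  cmdAt-⊑-just {s} {s'} ex t j h = trans (cmdAt-⊑ {s' = s'} ex t j (cmdAt-just⇒≤len s t j h)) h

  module _ {s s' : State} (ex : s ⊑ s') where
    private
      DefAt-⊑ : ∀ {t k r} → DefAt s t k r → DefAt s' t k r
      DefAt-⊑ {t} {k} (c , eq , d) = c , cmdAt-⊑-just ex t k eq , d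

      DefAt-⊒ : ∀ {t k r} → k ≤ len s t → DefAt s' t k r → DefAt s t k r
      DefAt-⊒ {t} {k} k≤ (c , eq , d) = c , trans (sym (cmdAt-⊑ ex t k k≤)) eq , d

    LastDef-⊑ : ∀ {t i r j} → i ≤ len s t → LastDef s t i r j → LastDef s' t i r j
    LastDef-⊑ i≤ (j<i , d , none-between) =
      j<i , DefAt-⊑ d , λ k j<k k<i d' → none-between k j<k k<i (DefAt-⊒ (ℕ.≤-trans (ℕ.<⇒≤ k<i) i≤) d')

    NoDef-⊑ : ∀ {t i r} → i ≤ len s t → NoDef s t i r → NoDef s' t i r
    NoDef-⊑ i≤ none j j<i d' = none j j<i (DefAt-⊒ (ℕ.≤-trans (ℕ.<⇒≤ j<i) i≤) d')

    -- Only ⊥ can change: a load that was unsatisfied may since have read a store.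
    mutual
      Eval-⊑ : ∀ {t i e w} → i ≤ len s t → Eval s t i e w → w ≢ nothing → Eval s' t i e w
      Eval-⊑ i≤ ev-const _ = ev-const
      Eval-⊑ i≤ (ev-app {f = f} {vs = vs} evs) w≢⊥ =
        ev-app (EvalV-⊑ i≤ evs (λ some⊥ → w≢⊥ (proj₂ (SFun.strict f vs) some⊥)))
      Eval-⊑ i≤ (ev-none none) _ = ev-none (NoDef-⊑ i≤ none)
      Eval-⊑ i≤ (ev-assign last c ev) w≢⊥ =
        ev-assign (LastDef-⊑ i≤ last) (cmdAt-⊑-just ex _ _ c)
                  (Eval-⊑ (ℕ.≤-trans (ℕ.<⇒≤ (proj₁ last)) i≤) ev w≢⊥)
      Eval-⊑ i≤ (ev-load⊥ _ _ _) w≢⊥ = ⊥-elim (w≢⊥ refl)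
      Eval-⊑ i≤ (ev-loadInit last c read) _ =
        ev-loadInit (LastDef-⊑ i≤ last) (cmdAt-⊑-just ex _ _ c) (loads-stable ex _ _ read)
      Eval-⊑ i≤ (ev-loadSt {t' = t'} {i' = i'} last c read c' ev) w≢⊥ =
        ev-loadSt (LastDef-⊑ i≤ last) (cmdAt-⊑-just ex _ _ c) (loads-stable ex _ _ read)
                  (cmdAt-⊑-just ex _ _ c') (Eval-⊑ (cmdAt-just⇒≤len s t' i' c') ev w≢⊥)

      EvalV-⊑ : ∀ {t i k} {es : Vec Expr k} {vs} → i ≤ len s t →
                EvalV s t i es vs → ¬ Any (_≡ nothing) vs → EvalV s' t i es vs
      EvalV-⊑ i≤ []         _   = []
      EvalV-⊑ i≤ (ev ∷ evs) no⊥ = Eval-⊑ i≤ ev (no⊥ ∘ here) ∷ EvalV-⊑ i≤ evs (no⊥ ∘ there)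

  Eval-⊑-just : ∀ {s s'} → s ⊑ s' → ∀ {t i c e v} → cmdAt s t i ≡ just c →
                Eval s t i e (just v) → Eval s' t i e (just v)
  Eval-⊑-just {s} ex {t} {i} c ev = Eval-⊑ ex (cmdAt-just⇒≤len s t i c) ev (λ ())

  module RegisterDefinition (s : State) (t : Tid) (i : ℕ) (r : Reg) where
    LastDef-unique : ∀ {j j'} → LastDef s t i r j → LastDef s t i r j' → j ≡ j'
    LastDef-unique {j} {j'} (j<i , d , none-after-j) (j'<i , d' , none-after-j') with ℕ.<-cmp j j'
    ... | tri< j<j' _ _ = ⊥-elim (none-after-j j' j<j' j'<i d')
    ... | tri≈ _ j≡j' _ = j≡j'
    ... | tri> _ _ j'<j = ⊥-elim (none-after-j' j j'<j j<i d)

    NoDef⇒¬LastDef : ∀ {j} → NoDef s t i r → ¬ LastDef s t i r j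
    NoDef⇒¬LastDef none (j<i , d , _) = none _ j<i d

    sameSite : ∀ {j j' c c'} → LastDef s t i r j → cmdAt s t j ≡ just c →
               LastDef s t i r j' → cmdAt s t j' ≡ just c' → (j , c) ≡ (j' , c')
    sameSite last c last' c' with refl ← LastDef-unique last last' =
      cong (_ ,_) (just-injective (trans (sym c) c'))

  mutual
    Eval-deterministic : ∀ {s t i e v w} → Eval s t i e v → Eval s t i e w → v ≡ w
    Eval-deterministic ev-const ev-const = refl
    Eval-deterministic (ev-app {f = f} evs) (ev-app evs') = cong (SFun.fn f) (EvalV-deterministic evs evs')
    Eval-deterministic {s} {t} {i} {reg r} {v} {w} = register
      where
        open RegisterDefinition s t i r

        -- Both derivations consult the same last definition of r, hence the same command
        -- and, for a load, the same store read.
        register : Eval s t i (reg r) v → Eval s t i (reg r) w → v ≡ w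
        register (ev-none _) (ev-none _) = refl
        register (ev-none none) (ev-assign last _ _)     = ⊥-elim (NoDef⇒¬LastDef none last)
        register (ev-none none) (ev-load⊥ last _ _)      = ⊥-elim (NoDef⇒¬LastDef none last)
        register (ev-none none) (ev-loadInit last _ _)   = ⊥-elim (NoDef⇒¬LastDef none last)
        register (ev-none none) (ev-loadSt last _ _ _ _) = ⊥-elim (NoDef⇒¬LastDef none last)
        register (ev-assign last _ _)     (ev-none none) = ⊥-elim (NoDef⇒¬LastDef none last)
        register (ev-load⊥ last _ _)      (ev-none none) = ⊥-elim (NoDef⇒¬LastDef none last)
        register (ev-loadInit last _ _)   (ev-none none) = ⊥-elim (NoDef⇒¬LastDef none last)
        register (ev-loadSt last _ _ _ _) (ev-none none) = ⊥-elim (NoDef⇒¬LastDef none last)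
        register (ev-assign last c ev) (ev-assign last' c' ev')
          with refl ← sameSite last c last' c' = Eval-deterministic ev ev'
        register (ev-assign last c _) (ev-load⊥ last' c' _)        with () ← sameSite last c last' c'
        register (ev-assign last c _) (ev-loadInit last' c' _)     with () ← sameSite last c last' c'
        register (ev-assign last c _) (ev-loadSt last' c' _ _ _)   with () ← sameSite last c last' c'
        register (ev-load⊥ last c _) (ev-assign last' c' _)        with () ← sameSite last c last' c'
        register (ev-loadInit last c _) (ev-assign last' c' _)     with () ← sameSite last c last' c'
        register (ev-loadSt last c _ _ _) (ev-assign last' c' _)   with () ← sameSite last c last' c'
        register (ev-load⊥ _ _ _) (ev-load⊥ _ _ _)         = refl
        register (ev-loadInit _ _ _) (ev-loadInit _ _ _)   = refl
        register (ev-load⊥ last c read) (ev-loadInit last' c' read')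
          with refl ← sameSite last c last' c' with () ← trans (sym read) read'
        register (ev-load⊥ last c read) (ev-loadSt last' c' read' _ _)
          with refl ← sameSite last c last' c' with () ← trans (sym read) read'
        register (ev-loadInit last c read) (ev-load⊥ last' c' read')
          with refl ← sameSite last c last' c' with () ← trans (sym read) read'
        register (ev-loadInit last c read) (ev-loadSt last' c' read' _ _)
          with refl ← sameSite last c last' c' with () ← trans (sym read) read'
        register (ev-loadSt last c read _ _) (ev-load⊥ last' c' read')
          with refl ← sameSite last c last' c' with () ← trans (sym read) read'
        register (ev-loadSt last c read _ _) (ev-loadInit last' c' read')
          with refl ← sameSite last c last' c' with () ← trans (sym read) read'
        register (ev-loadSt last c read c-st ev) (ev-loadSt last' c' read' c-st' ev')
          with refl ← sameSite last c last' c' with refl ← trans (sym read) read'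
          with refl ← trans (sym c-st) c-st' = Eval-deterministic ev ev'

    EvalV-deterministic : ∀ {s t i k} {es : Vec Expr k} {vs ws} →
                          EvalV s t i es vs → EvalV s t i es ws → vs ≡ ws
    EvalV-deterministic []         []           = refl
    EvalV-deterministic (ev ∷ evs) (ev' ∷ evs') =
      cong₂ Vec._∷_ (Eval-deterministic ev ev') (EvalV-deterministic evs evs')

  record KeyInvariant (s : State) : Set where
    field
      uncommitted-unkeyed : ∀ t j → Cm s t j ≡ false → co s (st t j) ≡ nothing
      propagated-keyed    : ∀ t a → ∃ λ q → co s (prop s t a) ≡ just q
  open KeyInvariant

  initState-KeyInvariant : KeyInvariant initState
  initState-KeyInvariant = record
    { uncommitted-unkeyed = λ _ _ _ → refl
    ; propagated-keyed    = λ _ _ → _ , refl }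

  step-keeps-key : ∀ {s l s'} → KeyInvariant s → Step s l s' → ∀ ρ {q} → co s ρ ≡ just q → co s' ρ ≡ just q
  step-keeps-key _ (FETCH _ _)                 _ h = h
  step-keeps-key _ (LOAD _ _ _)                _ h = h
  step-keeps-key _ (EARLY _ _ _ _ _ _ _ _ _)   _ h = h
  step-keeps-key _ (COMMIT _ _ _ _)            _ h = h
  step-keeps-key _ (PROP _ _ _ _)              _ h = h
  step-keeps-key _ (STORE _ _ _ _ _ _ _ _) (init _) h = h
  step-keeps-key {s} inv (STORE {t} {i} {k} _ uncommitted _ _ _ _ _ _) (st t' j) h
    with co-setCo (setC s t i) t i k t' j
  ... | inj₁ unchanged     = trans unchanged h
  ... | inj₂ (refl , refl) with () ← trans (sym (uncommitted-unkeyed inv t i uncommitted)) h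

  KeyInvariant-sameKeys : ∀ {s s'} → KeyInvariant s → s ⊑ s' →
                          co s' ≡ co s → prop s' ≡ prop s → KeyInvariant s'
  KeyInvariant-sameKeys inv ex co≡ prop≡ = record
    { uncommitted-unkeyed = λ t j h →
        subst (λ c → c (st t j) ≡ nothing) (sym co≡) (uncommitted-unkeyed inv t j (uncommitted-⊒ ex t j h))
    ; propagated-keyed    = λ t a →
        subst₂ (λ c p → ∃ λ q → c (p t a) ≡ just q) (sym co≡) (sym prop≡) (propagated-keyed inv t a) }

  <m⇒just : ∀ {x y} → x <m y → ∃ λ q → y ≡ just q
  <m⇒just {just _} {just _} _ = _ , refl

  step-KeyInvariant : ∀ {s l s'} → KeyInvariant s → Step s l s' → KeyInvariant s'
  step-KeyInvariant inv stp@(FETCH _ _)               = KeyInvariant-sameKeys inv (step-⊑ stp) refl refl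
  step-KeyInvariant inv stp@(LOAD _ _ _)              = KeyInvariant-sameKeys inv (step-⊑ stp) refl refl
  step-KeyInvariant inv stp@(EARLY _ _ _ _ _ _ _ _ _) = KeyInvariant-sameKeys inv (step-⊑ stp) refl refl
  step-KeyInvariant inv stp@(COMMIT _ _ _ _)          = KeyInvariant-sameKeys inv (step-⊑ stp) refl refl
  step-KeyInvariant {s} inv stp@(PROP {t₀} {t₁} {i₁} {a₀} _ _ _ newer) = record
    { uncommitted-unkeyed = uncommitted-unkeyed inv
    ; propagated-keyed    = keyed }
    where
      keyed : ∀ t a → ∃ λ q → co s (prop (setProp s t₀ a₀ (st t₁ i₁)) t a) ≡ just q
      keyed t a with prop-setProp s t₀ a₀ (st t₁ i₁) t a
      ... | inj₁ unchanged     rewrite unchanged = propagated-keyed inv t a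
      ... | inj₂ (refl , refl) rewrite prop-setProp-self s t a (st t₁ i₁) = <m⇒just newer
  step-KeyInvariant {s} inv stp@(STORE {t₀} {i₀} {k} {a₀} _ _ _ _ _ _ _ _) = record
    { uncommitted-unkeyed = unkeyed
    ; propagated-keyed    = keyed }
    where
      s₁ = setCo (setC s t₀ i₀) t₀ i₀ k
      unkeyed : ∀ t j → Cm (setC s t₀ i₀) t j ≡ false → co s₁ (st t j) ≡ nothing
      unkeyed t j h with co-setCo (setC s t₀ i₀) t₀ i₀ k t j
      ... | inj₁ unchanged     = trans unchanged (uncommitted-unkeyed inv t j (uncommitted-⊒ (step-⊑ stp) t j h))
      ... | inj₂ (refl , refl) with () ← trans (sym (Cm-setC-self s t₀ i₀)) h
      keyed : ∀ t a → ∃ λ q → co s₁ (prop (setProp s₁ t₀ a₀ (st t₀ i₀)) t a) ≡ just q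
      keyed t a with prop-setProp s₁ t₀ a₀ (st t₀ i₀) t a
      ... | inj₁ unchanged     rewrite unchanged =
        let q , key = propagated-keyed inv t a in q , step-keeps-key inv stp _ key
      ... | inj₂ (refl , refl) rewrite prop-setProp-self s₁ t a (st t i₀) = k , co-setCo-self (setC s t i₀) t i₀ k

  run-keeps-key : ∀ {s σ s'} → KeyInvariant s → Run s σ s' → ∀ ρ {q} → co s ρ ≡ just q → co s' ρ ≡ just q
  run-keeps-key inv run ρ {q} key =
    proj₂ (run-preserves (λ s → KeyInvariant s × co s ρ ≡ just q)
                         (λ (inv , key) stp → step-KeyInvariant inv stp , step-keeps-key inv stp ρ key)
                         (inv , key) run)

  ≤m-persists : ∀ {q m m'} → (∀ {x} → m ≡ just x → m' ≡ just x) → just q ≤m m → just q ≤m m'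
  ≤m-persists {m = just _} persists q≤ = subst (_ ≤m_) (sym (persists refl)) q≤

  ≤m-<m-trans : ∀ {q m k} → just q ≤m m → m <m just k → q ℚ.< k
  ≤m-<m-trans {m = just _} = ℚₚ.≤-<-trans

  ≤m-<m-weaken : ∀ {q m m'} → just q ≤m m → m <m m' → just q ≤m m'
  ≤m-<m-weaken {m = just _} {just _} q≤m m<m' = ℚₚ.≤-trans q≤m (ℚₚ.<⇒≤ m<m')

  step-prop-lowerBound : ∀ {s l s'} → KeyInvariant s → Step s l s' → ∀ t a {q} →
                         just q ≤m co s (prop s t a) → just q ≤m co s' (prop s' t a)
  step-prop-lowerBound _ (FETCH _ _)               _ _ q≤ = q≤
  step-prop-lowerBound _ (LOAD _ _ _)              _ _ q≤ = q≤
  step-prop-lowerBound _ (EARLY _ _ _ _ _ _ _ _ _) _ _ q≤ = q≤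
  step-prop-lowerBound _ (COMMIT _ _ _ _)          _ _ q≤ = q≤
  step-prop-lowerBound {s} _ (PROP {t₀} {t₁} {i₁} {a₀} _ _ _ newer) t a q≤
    with prop-setProp s t₀ a₀ (st t₁ i₁) t a
  ... | inj₁ unchanged     rewrite unchanged = q≤
  ... | inj₂ (refl , refl) rewrite prop-setProp-self s t a (st t₁ i₁) = ≤m-<m-weaken q≤ newer
  step-prop-lowerBound {s} inv stp@(STORE {t₀} {i₀} {k} {a₀} _ _ _ _ _ _ _ newer) t a q≤
    with prop-setProp (setCo (setC s t₀ i₀) t₀ i₀ k) t₀ a₀ (st t₀ i₀) t a
  ... | inj₁ unchanged     rewrite unchanged = ≤m-persists (step-keeps-key inv stp _) q≤
  ... | inj₂ (refl , refl)
      rewrite prop-setProp-self (setCo (setC s t i₀) t i₀ k) t a (st t i₀) | co-setCo-self (setC s t i₀) t i₀ k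
      = ℚₚ.<⇒≤ (≤m-<m-trans q≤ newer)

  module PendingStore (t : Tid) (i' : ℕ) (a : D) (q : ℚ) where
    StoreTo : State → Set
    StoreTo s = ∃₂ λ ea ev → cmdAt s t i' ≡ just (store ea ev) × Eval s t i' ea (just a)

    KeysAbove : State → Set
    KeysAbove s = just q ≤m co s (prop s t a) × (∀ {k} → co s (st t i') ≡ just k → q ℚ.< k)

    StoreTo-⊑ : ∀ {s s'} → s ⊑ s' → StoreTo s → StoreTo s'
    StoreTo-⊑ ex (ea , ev , c , addr) = ea , ev , cmdAt-⊑-just ex t i' c , Eval-⊑-just ex c addr

    step-KeysAbove : ∀ {s l s'} → KeyInvariant s → StoreTo s → KeysAbove s → Step s l s' → KeysAbove s'
    step-KeysAbove {s} inv (ea , ev , c , addr) (q≤ , above) stp =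
      step-prop-lowerBound inv stp t a q≤ , storeKey stp
      where
        storeKey : ∀ {l s'} → Step s l s' → ∀ {k} → co s' (st t i') ≡ just k → q ℚ.< k
        storeKey (FETCH _ _)               = above
        storeKey (LOAD _ _ _)              = above
        storeKey (EARLY _ _ _ _ _ _ _ _ _) = above
        storeKey (COMMIT _ _ _ _)          = above
        storeKey (PROP _ _ _ _)            = above
        storeKey (STORE {t₀} {i₀} {k} {a₀} c₀ _ _ addr₀ _ _ _ newer) key
          with co-setCo (setC s t₀ i₀) t₀ i₀ k t i'
        ... | inj₁ unchanged = above (trans (sym unchanged) key)
        ... | inj₂ (refl , refl)
            with refl ← trans (sym c) c₀ with refl ← Eval-deterministic addr addr₀
            with refl ← just-injective (trans (sym (co-setCo-self (setC s t i') t i' k)) key)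
            = ≤m-<m-trans q≤ newer

    run-KeysAbove : ∀ {s σ s'} → KeyInvariant s → StoreTo s → KeysAbove s → Run s σ s' → KeysAbove s'
    run-KeysAbove inv storeTo above run =
      proj₂ (proj₂ (run-preserves (λ s → KeyInvariant s × StoreTo s × KeysAbove s)
        (λ (inv , storeTo , above) stp →
          step-KeyInvariant inv stp , StoreTo-⊑ (step-⊑ stp) storeTo , step-KeysAbove inv storeTo above stp)
        (inv , storeTo , above) run))

  keyAbove-≰m : ∀ {q m} → (∀ {k} → m ≡ just k → q ℚ.< k) → ¬ (m ≤m just q)
  keyAbove-≰m {m = just _} above k≤q = ℚₚ.<-irrefl refl (ℚₚ.<-≤-trans (above refl) k≤q)

  memoryLoad-past-pendingStore-¬Final :
    ∀ {s t i a r e i' ea ev σ sf} → KeyInvariant s →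
    cmdAt s t i ≡ just (load r e) → Lm s t i ≡ nothing → Eval s t i e (just a) →
    i' < i → cmdAt s t i' ≡ just (store ea ev) → Eval s t i' ea (just a) → Cm s t i' ≡ false →
    Run (setL s t i (just (prop s t a))) σ sf → ¬ Final sf
  memoryLoad-past-pendingStore-¬Final {s} {t} {i} {a} {r} {e} {i'} {ea} {ev} {sf = sf}
    inv c-ld unread addr i'<i c-st addr' uncommitted run (_ , _ , storeKey≤readKey)
    with q , key ← propagated-keyed inv t a =
    keyAbove-≰m (proj₂ pending) (subst (co sf (st t i') ≤m_) readKey storeKey≤q)
    where
      open PendingStore t i' a q
      memoryLoad = LOAD c-ld unread addr
      s⊑sf = ⊑-trans (step-⊑ memoryLoad) (run-⊑ run)

      pending : KeysAbove sf
      pending = run-KeysAbove (step-KeyInvariant inv memoryLoad)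
        (StoreTo-⊑ (step-⊑ memoryLoad) (ea , ev , c-st , addr'))
        ( subst (just q ≤m_) (sym key) ℚₚ.≤-refl
        , λ keyed → case trans (sym (uncommitted-unkeyed inv t i' uncommitted)) keyed of λ () )
        run

      readKey : coL sf t i ≡ just q
      readKey = trans (cong (Maybe._>>= co sf) (loads-stable (run-⊑ run) t i (Lm-setL-self s t i _)))
                      (run-keeps-key (step-KeyInvariant inv memoryLoad) run _ key)

      storeKey≤q : co sf (st t i') ≤m coL sf t i
      storeKey≤q = storeKey≤readKey t i' i a ea ev r e i'<i
        (cmdAt-⊑-just s⊑sf t i' c-st) (cmdAt-⊑-just s⊑sf t i c-ld)
        (Eval-⊑-just s⊑sf c-st addr') (Eval-⊑-just s⊑sf c-ld addr)

  step-deterministic : ∀ {s l s₁ s₂ σ f₁ f₂} → KeyInvariant s →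
                       Step s l s₁ → Run s₁ σ f₁ → Final f₁ →
                       Step s l s₂ → Run s₂ σ f₂ → Final f₂ → s₁ ≡ s₂
  step-deterministic _ (FETCH _ _)  _ _ (FETCH _ _)  _ _ = refl
  step-deterministic _ (LOAD _ _ _) _ _ (LOAD _ _ _) _ _ = refl
  step-deterministic inv (LOAD _ _ _) run final (EARLY c-ld unread addr i'<i c-st _ addr' _ uncommitted) _ _ =
    ⊥-elim (memoryLoad-past-pendingStore-¬Final inv c-ld unread addr i'<i c-st addr' uncommitted run final)
  step-deterministic inv (EARLY c-ld unread addr i'<i c-st _ addr' _ uncommitted) _ _ (LOAD _ _ _) run final =
    ⊥-elim (memoryLoad-past-pendingStore-¬Final inv c-ld unread addr i'<i c-st addr' uncommitted run final)
  step-deterministic _ (EARLY {i' = j₁} _ _ _ j₁<i c₁ latest₁ addr₁ _ _) _ _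
                       (EARLY {i' = j₂} _ _ _ j₂<i c₂ latest₂ addr₂ _ _) _ _ with ℕ.<-cmp j₁ j₂
  ... | tri< j₁<j₂ _ _ = ⊥-elim (proj₁ (latest₁ j₂ j₁<j₂ j₂<i _ _ c₂) addr₂)
  ... | tri≈ _ refl _  = refl
  ... | tri> _ _ j₂<j₁ = ⊥-elim (proj₁ (latest₂ j₁ j₂<j₁ j₁<i _ _ c₁) addr₁)
  step-deterministic _ (COMMIT _ _ _ _)         _ _ (COMMIT _ _ _ _)         _ _ = refl
  step-deterministic _ (STORE _ _ _ _ _ _ _ _)  _ _ (STORE _ _ _ _ _ _ _ _)  _ _ = refl
  step-deterministic _ (PROP _ _ _ _)           _ _ (PROP _ _ _ _)           _ _ = refl

  run-deterministic : ∀ {s σ f₁ f₂} → KeyInvariant s →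
                      Run s σ f₁ → Final f₁ → Run s σ f₂ → Final f₂ → f₁ ≡ f₂
  run-deterministic _ done _ done _ = refl
  run-deterministic inv (step stp₁ run₁) final₁ (step stp₂ run₂) final₂
    with refl ← step-deterministic inv stp₁ run₁ final₁ stp₂ run₂ final₂ =
    run-deterministic (step-KeyInvariant inv stp₁) run₁ final₁ run₂ final₂

  ≡⇒≈S : ∀ {s s'} → s ≡ s' → s ≈S s'
  ≡⇒≈S refl = (λ t → refl , λ _ _ _ → refl , refl) , (λ _ → refl) , (λ _ _ → refl)

lemma1 : (dm nr : ℕ) (P : Power.Program dm nr) →
         let open Power.Sem dm nr P in
         (σ : List Label) (s s' : State) →
         Run initState σ s → Final s →
         Run initState σ s' → Final s' →
         s ≈S s'
lemma1 dm nr P σ s s' run final run' final' =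
  ≡⇒≈S (run-deterministic initState-KeyInvariant run final run' final')
  where open Determinism dm nr P
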